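{- Let $G$ be a directed graph with a designated source vertex $s$, let $\lambda,k\geq 1$ be integers, and let $t$ be a vertex with $\textsc{max-flow}(s,t,G)=f$ for some positive integer $f$. Then any $(\min\{f,\lambda\}+k-1)$-FTRS of $G$ that differs from $G$ only in the in-edges of $t$ is a $(\lambda,k)$-FT-BFP of $G$.
   Context: Edges have unit capacity; $\textsc{max-flow}(s,t,G)$ is the maximum number of edge-disjoint $s$-to-$t$ paths and $G\setminus F$ is $G$ with the edges of $F$ deleted. For an integer $r\geq1$, an $r$-FTRS of a directed graph $G=(V,E)$ with source $s$ is a subgraph $H=(V,E_H)$, $E_H\subseteq E$, such that for every $F\subseteq E$ with $|F|\leq r$ and every $v\in V$, $v$ is reachable from $s$ in $H\setminus F$ iff it is reachable from $s$ in $G\setminus F$. A $(\lambda,k)$-FT-BFP of $G$ is a subgraph $H=(V,E_H)$, $E_H\subseteq E$, such that for every $F\subseteq E$ with $|F|\leq k$ and every $t'\in V$: if $\textsc{max-flow}(s,t',G\setminus F)\leq\lambda$ then $\textsc{max-flow}(s,t',H\setminus F)=\textsc{max-flow}(s,t',G\setminus F)$, and otherwise $\textsc{max-flow}(s,t',H\setminus F)\geq\lambda$. -}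

module Defs where

open import Data.Nat using (ℕ; zero; suc; _+_; _∸_; _≤_; _<_; _⊓_)
open import Data.Fin using (Fin)
open import Data.Fin.Subset using (Subset; _∈_; _∉_; ∣_∣)
open import Data.List using (List; []; _∷_; _++_; concat)
open import Data.List.Relation.Unary.Unique.Propositional using (Unique)
open import Data.Vec using (Vec; map)
open import Data.Product using (Σ; ∃; ∃-syntax; _×_; _,_)
open import Relation.Binary.PropositionalEquality using (_≡_; _≢_)
open import Relation.Nullary using (¬_)
open import Function.Definitions using (Injective)

record Digraph : Set where
  field
    n   : ℕ
    m   : ℕ
    src : Fin m → Fin n
    tgt : Fin m → Fin n

open Digraph public

Vertex : Digraph → Set
Vertex G = Fin (n G)

Edge : Digraph → Set
Edge G = Fin (m G)

EdgeSet : Digraph → Set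
EdgeSet G = Subset (m G)

-- No parallel edges: E is a set of ordered pairs of vertices.
Simple : Digraph → Set
Simple G = Injective _≡_ _≡_ (λ (e : Edge G) → (src G e , tgt G e))

Avail : (G : Digraph) → EdgeSet G → EdgeSet G → Edge G → Set
Avail G H F e = (e ∈ H) × (e ∉ F)

data Walk (G : Digraph) (ok : Edge G → Set) : Vertex G → Vertex G → List (Edge G) → Set where
  nil  : ∀ {u} → Walk G ok u u []
  cons : ∀ {u v es} (e : Edge G) → ok e → src G e ≡ u → Walk G ok (tgt G e) v es →
         Walk G ok u v (e ∷ es)

Reachable : (G : Digraph) → EdgeSet G → EdgeSet G → Vertex G → Vertex G → Set
Reachable G H F s v = ∃[ es ] Walk G (Avail G H F) s v es

data Paths (G : Digraph) (ok : Edge G → Set) (s t : Vertex G) : ℕ → List (Edge G) → Set where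
  none : Paths G ok s t zero []
  more : ∀ {j es rest} → Walk G ok s t es → Paths G ok s t j rest → Paths G ok s t (suc j) (es ++ rest)

-- There are at least j edge-disjoint s-t paths in H ∖ F
-- (all edges used, over all paths, are distinct).
HasPaths : (G : Digraph) → EdgeSet G → EdgeSet G → Vertex G → Vertex G → ℕ → Set
HasPaths G H F s t j = ∃[ es ] (Paths G (Avail G H F) s t j es × Unique es)

MaxFlow : (G : Digraph) → EdgeSet G → EdgeSet G → Vertex G → Vertex G → ℕ → Set
MaxFlow G H F s t g = HasPaths G H F s t g × ¬ HasPaths G H F s t (suc g)

open import Data.Fin.Subset using (⊤; ⊥) public

FTRS : (G : Digraph) (s : Vertex G) (r : ℕ) (H : EdgeSet G) → Set
FTRS G s r H = ∀ (F : EdgeSet G) → ∣ F ∣ ≤ r → ∀ (v : Vertex G) →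
  (Reachable G H F s v → Reachable G ⊤ F s v) × (Reachable G ⊤ F s v → Reachable G H F s v)

FTBFP : (G : Digraph) (s : Vertex G) (lam k : ℕ) (H : EdgeSet G) → Set
FTBFP G s lam k H = ∀ (F : EdgeSet G) → ∣ F ∣ ≤ k → ∀ (t' : Vertex G) →
  (¬ HasPaths G ⊤ F s t' (suc lam) →
     ∀ g → (MaxFlow G ⊤ F s t' g → MaxFlow G H F s t' g) × (MaxFlow G H F s t' g → MaxFlow G ⊤ F s t' g))
  ×
  (HasPaths G ⊤ F s t' (suc lam) → HasPaths G H F s t' lam)

{-# OPTIONS --safe #-}
-- Suppose G ∖ F has j ≤ λ edge-disjoint s–t′ paths but H ∖ F has fewer. By max-flow min-cut (proved
-- via Ford–Fulkerson) some R ∋ s, t′ ∉ R is left by fewer than j edges of H ∖ F. Shrink R to the part Q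
-- that s reaches in H ∖ F inside R; one of the j paths still leaves Q through an edge outside H, which
-- must enter t: a bypass of Q. Deleting F and the H ∖ F edges leaving Q separates t from s in H but not
-- in G, so the (min(f,λ)+k−1)-FTRS property forces at least min(f,λ) such edges. Thus f < λ, and
-- uncrossing Q with a minimum s–t cut D of G (at most f edges) gives a bypass inside D, whose edge
-- would be one edge too many leaving D.
module Submission where

open import Defs
open import Data.Bool using (Bool; true; false; _∧_; _∨_; not)
import Data.Bool as Bool
open import Data.Bool.Properties using (¬-not; not-¬; not-injective; ∧-zeroʳ)
open import Data.Empty using (⊥-elim)
open import Data.Fin using (Fin; zero; suc; _≟_; splitAt; join)
import Data.Fin.Properties as Fin
open import Data.Fin.Subset using (Subset; _∈_; _∉_; ∣_∣)
open import Data.Fin.Subset.Properties using (∈⊤; ∉⊥)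
open import Data.List using (List; []; _∷_; _++_; length; replicate; map)
open import Data.List.Membership.Propositional using () renaming (_∈_ to _∈ˡ_; _∉_ to _∉ˡ_)
open import Data.List.Membership.Propositional.Properties using (∈-++⁺ˡ; ∈-++⁺ʳ; ∈-++⁻)
open import Data.List.Relation.Binary.Disjoint.Propositional using (Disjoint)
open import Data.List.Relation.Unary.All as All using (All)
open import Data.List.Relation.Unary.All.Properties using (++⁻ʳ; ¬Any⇒All¬)
import Data.List.Relation.Unary.All.Properties as All
open import Data.List.Relation.Unary.AllPairs using ([]; _∷_)
open import Data.List.Relation.Unary.Any using (here; there)
open import Data.List.Relation.Unary.Unique.Propositional using (Unique)
open import Data.List.Relation.Unary.Unique.Propositional.Properties using (++⁺)
open import Data.Nat using (ℕ; zero; suc; _+_; _∸_; _⊓_; _≤_; _<_; _≤?_; _≤′_; ≤′-refl; ≤′-step; z≤n; s≤s; s≤s⁻¹)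
open import Data.Nat.Properties
  using ( +-comm; +-commutativeSemigroup; +-identityʳ; +-suc; +-cancelˡ-≡; +-cancelʳ-≤; +-cancelʳ-<
        ; +-mono-≤; +-monoˡ-≤; +-monoʳ-≤; +-mono-≤-<; +-mono-<-≤; ≤-refl; ≤-trans; <-≤-trans; ≤-<-trans
        ; <⇒≢; <⇒≱; ≮⇒≥; ≰⇒>; ≤ᵇ⇒≤; ≤⇒≤′; m≤n+m; m≤n⇒m≤1+n; n<1+n; m+[n∸m]≡n; ⊓-sel; module ≤-Reasoning)
open import Algebra.Properties.CommutativeSemigroup +-commutativeSemigroup using (interchange; x∙yz≈y∙xz)
open import Data.Nat.Tactic.RingSolver using (solve)
open import Data.Product using (Σ; ∃; ∃-syntax; _×_; _,_; proj₁; proj₂)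
open import Data.Sum using (_⊎_; inj₁; inj₂; [_,_]′; reduce)
open import Data.Vec using (tabulate; lookup)
open import Data.Vec.Functional using (updateAt)
open import Data.Vec.Functional.Properties using (updateAt-updates; updateAt-minimal)
open import Data.Vec.Properties using (lookup∘tabulate; tabulate∘lookup; []=⇒lookup; lookup⇒[]=)
open import Function using (id; _∘_)
open import Relation.Binary.PropositionalEquality
open import Relation.Nullary using (yes; no; ¬_; does)
open import Relation.Nullary.Decidable using (dec-true; dec-false)

⟦_⟧ : Bool → ℕ
⟦ true ⟧ = 1
⟦ false ⟧ = 0

count : ∀ {m} → (Fin m → Bool) → ℕ
count {zero} p = 0
count {suc m} p = ⟦ p zero ⟧ + count (p ∘ suc)

_⊆ᵇ_ : ∀ {m} → (Fin m → Bool) → (Fin m → Bool) → Set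
p ⊆ᵇ q = ∀ x → p x ≡ true → q x ≡ true

⊆ᵇ-false : ∀ {m} {p q : Fin m → Bool} {x} → p ⊆ᵇ q → q x ≡ false → p x ≡ false
⊆ᵇ-false p⊆q qx = ¬-not (λ px → not-¬ (p⊆q _ px) qx)

⟦⟧-mono : ∀ {a b} → (a ≡ true → b ≡ true) → ⟦ a ⟧ ≤ ⟦ b ⟧
⟦⟧-mono {false} _ = z≤n
⟦⟧-mono {true} a⇒b rewrite a⇒b refl = ≤-refl

count-cong : ∀ {m} {p q : Fin m → Bool} → p ≗ q → count p ≡ count q
count-cong {zero} p≗q = refl
count-cong {suc m} p≗q = cong₂ _+_ (cong ⟦_⟧ (p≗q zero)) (count-cong (p≗q ∘ suc))

count-mono : ∀ {m} {p q : Fin m → Bool} → p ⊆ᵇ q → count p ≤ count q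
count-mono {zero} p⊆q = z≤n
count-mono {suc m} p⊆q = +-mono-≤ (⟦⟧-mono (p⊆q zero)) (count-mono (p⊆q ∘ suc))

count≤ : ∀ {m} (p : Fin m → Bool) → count p ≤ m
count≤ {zero} p = z≤n
count≤ {suc m} p with p zero
... | true = s≤s (count≤ (p ∘ suc))
... | false = m≤n⇒m≤1+n (count≤ (p ∘ suc))

count-false : ∀ {m} {p : Fin m → Bool} → (∀ x → p x ≡ false) → count p ≡ 0
count-false {zero} p≡false = refl
count-false {suc m} p≡false rewrite p≡false zero = count-false (p≡false ∘ suc)

∧-split : ∀ a {b} → a ∧ b ≡ true → a ≡ true × b ≡ true
∧-split true b≡true = refl , b≡true

count-<  : ∀ {m} {p q : Fin m → Bool} {x} → p ⊆ᵇ q → p x ≡ false → q x ≡ true → count p < count q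
count-< {x = zero} p⊆q px qx rewrite px | qx = s≤s (count-mono (p⊆q ∘ suc))
count-< {x = suc x} p⊆q px qx =
  +-mono-≤-< (⟦⟧-mono (p⊆q zero)) (count-< (p⊆q ∘ suc) px qx)

count-+-mono : ∀ {m} {p q p′ q′ : Fin m → Bool} →
  (∀ x → ⟦ p x ⟧ + ⟦ q x ⟧ ≤ ⟦ p′ x ⟧ + ⟦ q′ x ⟧) → count p + count q ≤ count p′ + count q′
count-+-mono {zero} pointwise = z≤n
count-+-mono {suc m} {p} {q} {p′} {q′} pointwise =
  subst₂ _≤_ (interchange ⟦ p zero ⟧ ⟦ q zero ⟧ (count (p ∘ suc)) (count (q ∘ suc)))
             (interchange ⟦ p′ zero ⟧ ⟦ q′ zero ⟧ (count (p′ ∘ suc)) (count (q′ ∘ suc)))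
    (+-mono-≤ (pointwise zero) (count-+-mono (pointwise ∘ suc)))

count-∨ : ∀ {m} (p q : Fin m → Bool) → count (λ x → p x ∨ q x) ≤ count p + count q
count-∨ {zero} p q = z≤n
count-∨ {suc m} p q = begin
  ⟦ p zero ∨ q zero ⟧ + count (λ x → p (suc x) ∨ q (suc x))
    ≤⟨ +-mono-≤ (∨-bound (p zero) (q zero)) (count-∨ (p ∘ suc) (q ∘ suc)) ⟩
  (⟦ p zero ⟧ + ⟦ q zero ⟧) + (count (p ∘ suc) + count (q ∘ suc))
    ≡⟨ interchange ⟦ p zero ⟧ ⟦ q zero ⟧ (count (p ∘ suc)) (count (q ∘ suc)) ⟩
  count p + count q ∎
  where
  open ≤-Reasoning
  ∨-bound : ∀ a b → ⟦ a ∨ b ⟧ ≤ ⟦ a ⟧ + ⟦ b ⟧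
  ∨-bound true b = s≤s z≤n
  ∨-bound false b = ≤-refl

count-insert : ∀ {m} {p q : Fin m → Bool} {x} → (∀ y → y ≢ x → p y ≡ q y) →
  p x ≡ false → q x ≡ true → count q ≡ suc (count p)
count-insert {x = zero} p≡q px qx rewrite px | qx =
  cong suc (count-cong (λ y → sym (p≡q (suc y) λ ())))
count-insert {q = q} {x = suc x} p≡q px qx rewrite p≡q zero (λ ()) =
  trans (cong (⟦ q zero ⟧ +_) (count-insert (λ y y≢x → p≡q (suc y) (y≢x ∘ Fin.suc-injective)) px qx))
        (+-suc ⟦ q zero ⟧ _)

count-pos⇒∃ : ∀ {m} (p : Fin m → Bool) → 0 < count p → ∃ λ x → p x ≡ true
count-pos⇒∃ p pos with Fin.any? (λ x → p x Bool.≟ true)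
... | yes found = found
... | no ¬found = ⊥-elim (<⇒≢ pos (sym (count-false (λ x → ¬-not λ px → ¬found (x , px)))))

module _ {m : ℕ} (p : Fin m → Bool) (x : Fin m) where

  insert remove : Fin m → Bool
  insert = updateAt p x (λ _ → true)
  remove = updateAt p x (λ _ → false)

  insert-here : insert x ≡ true
  insert-here = updateAt-updates x p

  insert⁻ : ∀ {y} → insert y ≡ true → y ≡ x ⊎ p y ≡ true
  insert⁻ {y} iy with y ≟ x
  ... | yes y≡x = inj₁ y≡x
  ... | no y≢x = inj₂ (trans (sym (updateAt-minimal y x p y≢x)) iy)

  ⊆insert : p ⊆ᵇ insert
  ⊆insert y py with y ≟ x
  ... | yes refl = updateAt-updates x p
  ... | no y≢x = trans (updateAt-minimal y x p y≢x) py

  remove⊆ : remove ⊆ᵇ p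
  remove⊆ y ry with y ≟ x
  ... | yes refl = ⊥-elim (not-¬ ry (updateAt-updates x p))
  ... | no y≢x = trans (sym (updateAt-minimal y x p y≢x)) ry

count-unique : ∀ {m} {p : Fin m → Bool} {xs} → Unique xs → (∀ {x} → x ∈ˡ xs → p x ≡ true) →
  length xs ≤ count p
count-unique [] _ = z≤n
count-unique {p = p} {x ∷ xs} (x∉xs ∷ unique) xs⊆p =
  <-≤-trans (s≤s (count-unique unique rest⊆p)) (count-< (remove⊆ p x) (updateAt-updates x p) (xs⊆p (here refl)))
  where
  rest⊆p : ∀ {y} → y ∈ˡ xs → remove p x y ≡ true
  rest⊆p {y} y∈ = trans (updateAt-minimal y x p (λ y≡x → All.lookup x∉xs y∈ (sym y≡x))) (xs⊆p (there y∈))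

unique-++ʳ : ∀ {A : Set} (xs : List A) {ys} → Unique (xs ++ ys) → Unique ys
unique-++ʳ [] unique = unique
unique-++ʳ (x ∷ xs) (_ ∷ unique) = unique-++ʳ xs unique

unique-++-disjoint : ∀ {A : Set} (xs : List A) {ys} → Unique (xs ++ ys) → ∀ {x} → x ∈ˡ xs → x ∉ˡ ys
unique-++-disjoint (x ∷ xs) (x∉ ∷ _) (here refl) x∈ys = All.lookup (++⁻ʳ xs x∉) x∈ys refl
unique-++-disjoint (x ∷ xs) (_ ∷ unique) (there y∈xs) = unique-++-disjoint xs unique y∈xs

∣tabulate∣ : ∀ {m} (p : Fin m → Bool) → ∣ tabulate p ∣ ≡ count p
∣tabulate∣ {zero} p = refl
∣tabulate∣ {suc m} p with p zero
... | true = cong suc (∣tabulate∣ (p ∘ suc))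
... | false = ∣tabulate∣ (p ∘ suc)

∣∣≡count : ∀ {m} (X : Subset m) → ∣ X ∣ ≡ count (lookup X)
∣∣≡count X = trans (cong ∣_∣ (sym (tabulate∘lookup X))) (∣tabulate∣ (lookup X))

∈-tabulate : ∀ {m} {p : Fin m → Bool} {x} → p x ≡ true → x ∈ tabulate p
∈-tabulate {p = p} {x} px = lookup⇒[]= x _ (trans (lookup∘tabulate p x) px)

∉-tabulate : ∀ {m} {p : Fin m → Bool} {x} → p x ≡ false → x ∉ tabulate p
∉-tabulate {p = p} {x} px x∈ = not-¬ (trans (sym (lookup∘tabulate p x)) ([]=⇒lookup x∈)) px

∉⇒lookup-false : ∀ {m} {X : Subset m} {x} → x ∉ X → lookup X x ≡ false
∉⇒lookup-false {X = X} {x} x∉ = ¬-not (x∉ ∘ lookup⇒[]= x X)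

module Walks (G : Digraph) where

  open import Data.List.Membership.DecPropositional (Fin._≟_ {n = m G}) using (_∈?_)

  leaves : (Vertex G → Bool) → Edge G → Bool
  leaves P e = P (src G e) ∧ not (P (tgt G e))

  enters : (Vertex G → Bool) → Edge G → Bool
  enters P e = P (tgt G e) ∧ not (P (src G e))

  Inside : (Vertex G → Bool) → Edge G → Set
  Inside P e = P (src G e) ≡ true × P (tgt G e) ≡ true

  Closed : (Edge G → Set) → (Vertex G → Bool) → Set
  Closed ok P = ∀ {e} → ok e → P (src G e) ≡ true → P (tgt G e) ≡ true

  leaves⁺ : ∀ P {e} → P (src G e) ≡ true → P (tgt G e) ≡ false → leaves P e ≡ true
  leaves⁺ P Psrc Ptgt = cong₂ (λ a b → a ∧ not b) Psrc Ptgt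

  leaves⁻ : ∀ P {e} → leaves P e ≡ true → P (src G e) ≡ true × P (tgt G e) ≡ false
  leaves⁻ P {e} l with P (src G e) | P (tgt G e)
  ... | true | false = refl , refl

  inside⇒¬leaves : ∀ P {e} → Inside P e → leaves P e ≡ false
  inside⇒¬leaves P (Psrc , Ptgt) = cong₂ (λ a b → a ∧ not b) Psrc Ptgt

  enters⁻ : ∀ P {e} → enters P e ≡ true → P (tgt G e) ≡ true × P (src G e) ≡ false
  enters⁻ P {e} l with P (tgt G e) | P (src G e)
  ... | true | false = refl , refl

  DisjointPaths : (Edge G → Set) → Vertex G → Vertex G → ℕ → Set
  DisjointPaths ok s t j = ∃[ es ] (Paths G ok s t j es × Unique es)

  walk-map : ∀ {ok ok′ : Edge G → Set} → (∀ {e} → ok e → ok′ e) →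
    ∀ {u v es} → Walk G ok u v es → Walk G ok′ u v es
  walk-map f nil = nil
  walk-map f (cons e ok-e src≡ w) = cons e (f ok-e) src≡ (walk-map f w)

  paths-map : ∀ {ok ok′ : Edge G → Set} → (∀ {e} → ok e → ok′ e) →
    ∀ {s t j es} → Paths G ok s t j es → Paths G ok′ s t j es
  paths-map f none = none
  paths-map f (more w ps) = more (walk-map f w) (paths-map f ps)

  disjointPaths-map : ∀ {ok ok′ : Edge G → Set} → (∀ {e} → ok e → ok′ e) →
    ∀ {s t j} → DisjointPaths ok s t j → DisjointPaths ok′ s t j
  disjointPaths-map f (es , ps , unique) = es , paths-map f ps , unique

  module _ {ok : Edge G → Set} where

    _++ʷ_ : ∀ {u w v es es′} → Walk G ok u w es → Walk G ok w v es′ → Walk G ok u v (es ++ es′)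
    nil ++ʷ w′ = w′
    cons e ok-e src≡ w ++ʷ w′ = cons e ok-e src≡ (w ++ʷ w′)

    walk-edge-ok : ∀ {u v es e} → Walk G ok u v es → e ∈ˡ es → ok e
    walk-edge-ok (cons e ok-e _ _) (here refl) = ok-e
    walk-edge-ok (cons _ _ _ w) (there e∈) = walk-edge-ok w e∈

    paths-edge-ok : ∀ {s t j es e} → Paths G ok s t j es → e ∈ˡ es → ok e
    paths-edge-ok (more {es = es} w ps) e∈ with ∈-++⁻ es e∈
    ... | inj₁ e∈w = walk-edge-ok w e∈w
    ... | inj₂ e∈ps = paths-edge-ok ps e∈ps

    walk-stays : ∀ P {u v es} → Closed ok P → P u ≡ true → Walk G ok u v es → P v ≡ true
    walk-stays P closed Pu nil = Pu
    walk-stays P closed Pu (cons e ok-e refl w) = walk-stays P closed (closed ok-e Pu) w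

    walk-inside : ∀ P {u v es} → Closed ok P → P u ≡ true → Walk G ok u v es →
      Walk G (λ e → ok e × Inside P e) u v es
    walk-inside P closed Pu nil = nil
    walk-inside P closed Pu (cons e ok-e refl w) =
      cons e (ok-e , Pu , closed ok-e Pu) refl (walk-inside P closed (closed ok-e Pu) w)

    leaving-edge : ∀ P {u v es} → P u ≡ true → P v ≡ false → Walk G ok u v es →
      ∃[ e ] (e ∈ˡ es × ok e × leaves P e ≡ true)
    leaving-edge P Pu Pv nil = ⊥-elim (not-¬ Pu Pv)
    leaving-edge P Pu Pv (cons e ok-e refl w) with P (tgt G e) in Ptgt
    ... | false = e , here refl , ok-e , leaves⁺ P Pu Ptgt
    ... | true with leaving-edge P Ptgt Pv w
    ...   | e′ , e′∈ , ok-e′ , leaves-e′ = e′ , there e′∈ , ok-e′ , leaves-e′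

    suffix-walk : ∀ {u v es e} → Walk G ok u v es → Unique es → e ∈ˡ es →
      ∃[ es′ ] (Walk G ok (src G e) v es′ × Unique es′)
    suffix-walk (cons e ok-e _ w) unique (here refl) = _ , cons e ok-e refl w , unique
    suffix-walk (cons _ _ _ w) (_ ∷ unique) (there e∈) = suffix-walk w unique e∈

    -- If e recurs in the trail of the rest, that trail already yields one starting at src e.
    walk⇒trail : ∀ {u v es} → Walk G ok u v es → ∃[ es′ ] (Walk G ok u v es′ × Unique es′)
    walk⇒trail nil = [] , nil , []
    walk⇒trail (cons e ok-e refl w) with walk⇒trail w
    ... | es′ , w′ , unique with e ∈? es′
    ...   | yes e∈ = suffix-walk w′ unique e∈
    ...   | no e∉ = e ∷ es′ , cons e ok-e refl w′ , ¬Any⇒All¬ es′ e∉ ∷ unique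

    leaving-edges : ∀ P {s t j es} → P s ≡ true → P t ≡ false → Paths G ok s t j es → Unique es →
      ∃[ cs ] (length cs ≡ j × Unique cs × (∀ {c} → c ∈ˡ cs → c ∈ˡ es × ok c × leaves P c ≡ true))
    leaving-edges P Ps Pt none _ = [] , refl , [] , λ ()
    leaving-edges P Ps Pt (more {es = es} w ps) unique
      with leaving-edge P Ps Pt w | leaving-edges P Ps Pt ps (unique-++ʳ es unique)
    ... | e , e∈es , ok-e , leaves-e | cs , refl , unique-cs , cs-ok =
      e ∷ cs , refl ,
      ¬Any⇒All¬ cs (λ e∈cs → unique-++-disjoint es unique e∈es (proj₁ (cs-ok e∈cs))) ∷ unique-cs ,
      λ { (here refl) → ∈-++⁺ˡ e∈es , ok-e , leaves-e
        ; (there c∈cs) → let (c∈ps , ok-c , leaves-c) = cs-ok c∈cs in ∈-++⁺ʳ es c∈ps , ok-c , leaves-c }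

  paths≤cut : ∀ (ok : Edge G → Bool) P {s t j} → P s ≡ true → P t ≡ false →
    DisjointPaths (λ e → ok e ≡ true) s t j → j ≤ count (λ e → ok e ∧ leaves P e)
  paths≤cut ok P Ps Pt (es , ps , unique) with leaving-edges P Ps Pt ps unique
  ... | cs , refl , unique-cs , cs-ok =
    count-unique unique-cs λ c∈cs → let (_ , ok-c , leaves-c) = cs-ok c∈cs in cong₂ _∧_ ok-c leaves-c

  module _ {ok : Edge G → Set} {s t : Vertex G} where

    drop-path : ∀ {j} → DisjointPaths ok s t (suc j) → DisjointPaths ok s t j
    drop-path (_ , more {es = es} _ ps , unique) = _ , ps , unique-++ʳ es unique

    paths-≤ : ∀ {i j} → i ≤ j → DisjointPaths ok s t j → DisjointPaths ok s t i
    paths-≤ = go ∘ ≤⇒≤′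
      where
      go : ∀ {i j} → i ≤′ j → DisjointPaths ok s t j → DisjointPaths ok s t i
      go ≤′-refl = id
      go (≤′-step i≤′j) = go i≤′j ∘ drop-path

  trivial-paths : ∀ {ok s} j → DisjointPaths ok s s j
  trivial-paths {ok} {s} j = [] , loops j , []
    where
    loops : ∀ j → Paths G ok s s j []
    loops zero = none
    loops (suc j) = more nil (loops j)

module Reachability (G : Digraph) (ok : Edge G → Bool) (s : Vertex G) where

  open Walks G

  OK : Edge G → Set
  OK e = ok e ≡ true

  record Closure : Set where
    field
      member : Vertex G → Bool
      source : member s ≡ true
      closed : Closed OK member
      reachable : ∀ {v} → member v ≡ true → ∃[ es ] Walk G OK s v es

  private
    Reach : (Vertex G → Bool) → Set
    Reach R = ∀ {v} → R v ≡ true → ∃[ es ] Walk G OK s v es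

    grow : ∀ fuel R → n G ≤ count R + fuel → R s ≡ true → Reach R → Closure
    grow fuel R room Rs reach with Fin.any? (λ e → ok e ∧ leaves R e Bool.≟ true)
    ... | no ¬exit = record { member = R ; source = Rs ; closed = closed ; reachable = reach }
      where
      closed : Closed OK R
      closed {e} ok-e Rsrc = ¬-not λ Rtgt → ¬exit (e , cong₂ _∧_ ok-e (leaves⁺ R Rsrc Rtgt))
    ... | yes (e , exit) with ∧-split (ok e) exit
    ...   | ok-e , leaving with leaves⁻ R leaving
    ...     | Rsrc , Rtgt = step fuel room
      where
      R′ = insert R (tgt G e)
      grows : count R < count R′
      grows = count-< (⊆insert R (tgt G e)) Rtgt (insert-here R (tgt G e))
      reach′ : Reach R′
      reach′ v∈ with insert⁻ R (tgt G e) v∈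
      ... | inj₁ refl = let (es , w) = reach Rsrc in _ , w ++ʷ cons e ok-e refl nil
      ... | inj₂ Rv = reach Rv
      step : ∀ fuel → n G ≤ count R + fuel → Closure
      step zero room = ⊥-elim (<⇒≱ (<-≤-trans grows (count≤ R′)) (subst (n G ≤_) (+-identityʳ _) room))
      step (suc fuel) room =
        grow fuel R′ (≤-trans room (subst (_≤ count R′ + fuel) (sym (+-suc _ fuel)) (+-monoˡ-≤ fuel grows)))
          (⊆insert R (tgt G e) s Rs) reach′

  closure : Closure
  closure = grow (n G) R₀ (m≤n+m (n G) (count R₀)) (insert-here _ s) reach₀
    where
    R₀ = insert (λ _ → false) s
    reach₀ : Reach R₀
    reach₀ v∈ with insert⁻ _ s v∈
    ... | inj₁ refl = [] , nil

-- A unit flow is given by its set of edges; conservation is imposed on every vertex set S rather than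
-- per vertex, with supplies and demands as multisets of vertices.
module Flows (D : Digraph) where

  open Walks D

  outflow inflow : (Edge D → Bool) → (Vertex D → Bool) → ℕ
  outflow A S = count (λ e → A e ∧ leaves S e)
  inflow A S = count (λ e → A e ∧ enters S e)

  within : (Vertex D → Bool) → List (Vertex D) → ℕ
  within S [] = 0
  within S (v ∷ vs) = ⟦ S v ⟧ + within S vs

  record Balanced (A : Edge D → Bool) (supplies demands : List (Vertex D)) : Set where
    constructor balanced
    field conserved : ∀ S → outflow A S + within S demands ≡ inflow A S + within S supplies

  open Balanced public

  ｛_｝ : Vertex D → Vertex D → Bool
  ｛ v ｝ x = does (x ≟ v)

  ∈｛｝ : ∀ {v x} → ｛ v ｝ x ≡ true → x ≡ v
  ∈｛｝ {v} {x} x∈ with x ≟ v | x∈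
  ... | yes x≡v | _ = x≡v

  within-replicate-∈ : ∀ S {v} j → S v ≡ true → within S (replicate j v) ≡ j
  within-replicate-∈ S zero Sv = refl
  within-replicate-∈ S (suc j) Sv rewrite Sv = cong suc (within-replicate-∈ S j Sv)

  within-replicate-∉ : ∀ S {v} j → S v ≡ false → within S (replicate j v) ≡ 0
  within-replicate-∉ S zero Sv = refl
  within-replicate-∉ S (suc j) Sv rewrite Sv = within-replicate-∉ S j Sv

  edge-balance : ∀ S e → ⟦ leaves S e ⟧ + ⟦ S (tgt D e) ⟧ ≡ ⟦ enters S e ⟧ + ⟦ S (src D e) ⟧
  edge-balance S e with S (src D e) | S (tgt D e)
  ... | true | true = refl
  ... | true | false = refl
  ... | false | true = refl
  ... | false | false = refl

  no-flow : Balanced (λ _ → false) [] []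
  no-flow = balanced λ S → cong (_+ 0) (trans (count-false {m D} (λ _ → refl)) (sym (count-false {m D} (λ _ → refl))))

  balanced-cons : ∀ {A σ τ} v → Balanced A σ τ → Balanced A (v ∷ σ) (v ∷ τ)
  balanced-cons {A} {σ} {τ} v bal = balanced λ S → begin
    outflow A S + (⟦ S v ⟧ + within S τ) ≡⟨ x∙yz≈y∙xz (outflow A S) ⟦ S v ⟧ (within S τ) ⟩
    ⟦ S v ⟧ + (outflow A S + within S τ) ≡⟨ cong (⟦ S v ⟧ +_) (conserved bal S) ⟩
    ⟦ S v ⟧ + (inflow A S + within S σ)  ≡⟨ x∙yz≈y∙xz ⟦ S v ⟧ (inflow A S) (within S σ) ⟩
    inflow A S + (⟦ S v ⟧ + within S σ)  ∎
    where open ≡-Reasoning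

  balanced-uncons : ∀ {A σ τ} v → Balanced A (v ∷ σ) (v ∷ τ) → Balanced A σ τ
  balanced-uncons {A} {σ} {τ} v bal = balanced λ S → +-cancelˡ-≡ ⟦ S v ⟧ _ _ (begin
    ⟦ S v ⟧ + (outflow A S + within S τ) ≡⟨ x∙yz≈y∙xz ⟦ S v ⟧ (outflow A S) (within S τ) ⟩
    outflow A S + (⟦ S v ⟧ + within S τ) ≡⟨ conserved bal S ⟩
    inflow A S + (⟦ S v ⟧ + within S σ)  ≡⟨ x∙yz≈y∙xz (inflow A S) ⟦ S v ⟧ (within S σ) ⟩
    ⟦ S v ⟧ + (inflow A S + within S σ)  ∎)
    where open ≡-Reasoning

  record Adds (A A′ : Edge D → Bool) (e : Edge D) : Set where
    field
      absent : A e ≡ false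
      present : A′ e ≡ true
      agree : ∀ x → x ≢ e → A x ≡ A′ x

  insert-adds : ∀ {A e} → A e ≡ false → Adds A (insert A e) e
  insert-adds {A} {e} Ae = record
    { absent = Ae ; present = insert-here A e ; agree = λ x x≢e → sym (updateAt-minimal x e A x≢e) }

  remove-adds : ∀ {A e} → A e ≡ true → Adds (remove A e) A e
  remove-adds {A} {e} Ae = record
    { absent = updateAt-updates e A ; present = Ae ; agree = λ x x≢e → updateAt-minimal x e A x≢e }

  count-adds : ∀ {A A′ e} → Adds A A′ e → ∀ (P : Edge D → Bool) →
    count (λ x → A′ x ∧ P x) ≡ count (λ x → A x ∧ P x) + ⟦ P e ⟧
  count-adds {A} {A′} {e} adds P with P e in Pe
  ... | true = trans (count-insert (λ x x≢e → cong (_∧ P x) (agree x x≢e)) (cong₂ _∧_ absent Pe)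
                                   (cong₂ _∧_ present Pe))
                     (+-comm 1 _)
    where open Adds adds
  ... | false = trans (count-cong same) (sym (+-identityʳ _))
    where
    open Adds adds
    same : ∀ x → A′ x ∧ P x ≡ A x ∧ P x
    same x with x ≟ e
    ... | yes refl rewrite Pe = trans (∧-zeroʳ (A′ e)) (sym (∧-zeroʳ (A e)))
    ... | no x≢e = cong (_∧ P x) (sym (agree x x≢e))

  private
    shift : ∀ X Y L E {a b T V} → L + b ≡ E + a → X + (a + T) ≡ Y + V → (X + L) + (b + T) ≡ (Y + E) + V
    shift X Y L E {a} {b} {T} {V} edge bal = begin
      (X + L) + (b + T) ≡⟨ solve (X ∷ L ∷ b ∷ T ∷ []) ⟩
      (L + b) + (X + T) ≡⟨ cong (_+ (X + T)) edge ⟩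
      (E + a) + (X + T) ≡⟨ solve (E ∷ a ∷ X ∷ T ∷ []) ⟩
      E + (X + (a + T)) ≡⟨ cong (E +_) bal ⟩
      E + (Y + V)       ≡⟨ solve (E ∷ Y ∷ V ∷ []) ⟩
      (Y + E) + V       ∎
      where open ≡-Reasoning

    unshift : ∀ X Y L E {a b T V} → L + b ≡ E + a → (X + L) + (b + T) ≡ (Y + E) + V → X + (a + T) ≡ Y + V
    unshift X Y L E {a} {b} {T} {V} edge bal = +-cancelˡ-≡ E _ _ (begin
      E + (X + (a + T)) ≡⟨ solve (E ∷ X ∷ a ∷ T ∷ []) ⟩
      (E + a) + (X + T) ≡⟨ cong (_+ (X + T)) edge ⟨
      (L + b) + (X + T) ≡⟨ solve (L ∷ b ∷ X ∷ T ∷ []) ⟩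
      (X + L) + (b + T) ≡⟨ bal ⟩
      (Y + E) + V       ≡⟨ solve (Y ∷ E ∷ V ∷ []) ⟩
      E + (Y + V)       ∎)
      where open ≡-Reasoning

  module _ {A A′ e} (adds : Adds A A′ e) where

    outflow-adds : ∀ S → outflow A′ S ≡ outflow A S + ⟦ leaves S e ⟧
    outflow-adds S = count-adds adds (leaves S)

    inflow-adds : ∀ S → inflow A′ S ≡ inflow A S + ⟦ enters S e ⟧
    inflow-adds S = count-adds adds (enters S)

    add-moves-demand : ∀ {σ τ} → Balanced A σ (src D e ∷ τ) → Balanced A′ σ (tgt D e ∷ τ)
    add-moves-demand {σ} {τ} bal = balanced λ S → begin
      outflow A′ S + (⟦ S (tgt D e) ⟧ + within S τ)
        ≡⟨ cong (_+ _) (outflow-adds S) ⟩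
      (outflow A S + ⟦ leaves S e ⟧) + (⟦ S (tgt D e) ⟧ + within S τ)
        ≡⟨ shift (outflow A S) (inflow A S) ⟦ leaves S e ⟧ ⟦ enters S e ⟧ (edge-balance S e) (conserved bal S) ⟩
      (inflow A S + ⟦ enters S e ⟧) + within S σ
        ≡⟨ cong (_+ _) (inflow-adds S) ⟨
      inflow A′ S + within S σ ∎
      where open ≡-Reasoning

    remove-moves-demand : ∀ {σ τ} → Balanced A′ σ (tgt D e ∷ τ) → Balanced A σ (src D e ∷ τ)
    remove-moves-demand {σ} {τ} bal = balanced λ S →
      unshift (outflow A S) (inflow A S) ⟦ leaves S e ⟧ ⟦ enters S e ⟧ (edge-balance S e) (begin
        (outflow A S + ⟦ leaves S e ⟧) + (⟦ S (tgt D e) ⟧ + within S τ) ≡⟨ cong (_+ _) (outflow-adds S) ⟨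
        outflow A′ S + (⟦ S (tgt D e) ⟧ + within S τ)                   ≡⟨ conserved bal S ⟩
        inflow A′ S + within S σ                                       ≡⟨ cong (_+ _) (inflow-adds S) ⟩
        (inflow A S + ⟦ enters S e ⟧) + within S σ                     ∎)
      where open ≡-Reasoning

    remove-moves-supply : ∀ {σ τ} → Balanced A′ (src D e ∷ σ) τ → Balanced A (tgt D e ∷ σ) τ
    remove-moves-supply {σ} {τ} bal = balanced λ S →
      sym (unshift (inflow A S) (outflow A S) ⟦ enters S e ⟧ ⟦ leaves S e ⟧ (sym (edge-balance S e)) (begin
        (inflow A S + ⟦ enters S e ⟧) + (⟦ S (src D e) ⟧ + within S σ) ≡⟨ cong (_+ _) (inflow-adds S) ⟨
        inflow A′ S + (⟦ S (src D e) ⟧ + within S σ)                   ≡⟨ conserved bal S ⟨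
        outflow A′ S + within S τ                                      ≡⟨ cong (_+ _) (outflow-adds S) ⟩
        (outflow A S + ⟦ leaves S e ⟧) + within S τ                    ∎))
      where open ≡-Reasoning

  value≤edges : ∀ {A j s t} → s ≢ t → Balanced A (replicate j s) (replicate j t) → j ≤ m D
  value≤edges {A} {j} {s} {t} s≢t bal = begin
    j                                               ≤⟨ m≤n+m j _ ⟩
    inflow A ｛ s ｝ + j                              ≡⟨ cong (inflow A ｛ s ｝ +_) s-supplies ⟨
    inflow A ｛ s ｝ + within ｛ s ｝ (replicate j s)  ≡⟨ conserved bal ｛ s ｝ ⟨
    outflow A ｛ s ｝ + within ｛ s ｝ (replicate j t) ≡⟨ cong (outflow A ｛ s ｝ +_) no-demand ⟩
    outflow A ｛ s ｝ + 0                             ≡⟨ +-identityʳ _ ⟩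
    outflow A ｛ s ｝                                 ≤⟨ count≤ _ ⟩
    m D                                             ∎
    where
    open ≤-Reasoning
    s-supplies = within-replicate-∈ ｛ s ｝ j (dec-true (s ≟ s) refl)
    no-demand = within-replicate-∉ ｛ s ｝ j (dec-false (t ≟ s) (s≢t ∘ sym))

  module _ (t : Vertex D) where

    record Peeled (A : Edge D → Bool) (v : Vertex D) (σ : List (Vertex D)) (j : ℕ) : Set where
      field
        edges : List (Edge D)
        walk : Walk D (λ e → A e ≡ true) v t edges
        unique : Unique edges
        rest : Edge D → Bool
        rest⊆A : rest ⊆ᵇ A
        edges∉rest : ∀ {e} → e ∈ˡ edges → rest e ≡ false
        rest-balanced : Balanced rest σ (replicate j t)

    source-exits : ∀ {A v σ j} → v ≢ t → Balanced A (v ∷ σ) (replicate (suc j) t) → 0 < outflow A ｛ v ｝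
    source-exits {A} {v} {σ} {j} v≢t bal = begin-strict
      0                                                     <⟨ s≤s z≤n ⟩
      suc (inflow A ｛ v ｝ + within ｛ v ｝ σ)                ≡⟨ +-suc _ _ ⟨
      inflow A ｛ v ｝ + suc (within ｛ v ｝ σ)                ≡⟨ cong (λ x → inflow A ｛ v ｝ + (⟦ x ⟧ + within ｛ v ｝ σ)) v∈ ⟨
      inflow A ｛ v ｝ + (⟦ ｛ v ｝ v ⟧ + within ｛ v ｝ σ)     ≡⟨ conserved bal ｛ v ｝ ⟨
      outflow A ｛ v ｝ + within ｛ v ｝ (replicate (suc j) t) ≡⟨ cong (outflow A ｛ v ｝ +_) no-demand ⟩
      outflow A ｛ v ｝ + 0                                  ≡⟨ +-identityʳ _ ⟩
      outflow A ｛ v ｝                                      ∎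
      where
      open ≤-Reasoning
      v∈ = dec-true (v ≟ v) refl
      no-demand = within-replicate-∉ ｛ v ｝ (suc j) (dec-false (t ≟ v) (v≢t ∘ sym))

    peel : ∀ fuel {A v σ j} → count A < fuel → Balanced A (v ∷ σ) (replicate (suc j) t) → Peeled A v σ j
    peel fuel {A} {v} {σ} {j} bounded bal with v ≟ t
    ... | yes refl = record
      { edges = [] ; walk = nil ; unique = [] ; rest = A ; rest⊆A = λ _ → id ; edges∉rest = λ ()
      ; rest-balanced = balanced-uncons t bal }
    ... | no v≢t with count-pos⇒∃ (λ x → A x ∧ leaves ｛ v ｝ x) (source-exits v≢t bal)
    ...   | e , exit with ∧-split (A e) exit
    ...     | Ae , leaving = step fuel bounded
      where
      src≡v = ∈｛｝ (proj₁ (leaves⁻ ｛ v ｝ leaving))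
      adds = remove-adds Ae
      shrinks : count (remove A e) < count A
      shrinks = count-< (remove⊆ A e) (Adds.absent adds) Ae
      step : ∀ fuel → count A < fuel → Peeled A v σ j
      step (suc fuel) bounded = record
        { edges = e ∷ edges
        ; walk = cons e Ae src≡v (walk-map (remove⊆ A e _) walk)
        ; unique = ¬Any⇒All¬ edges (λ e∈ → not-¬ (walk-edge-ok walk e∈) (Adds.absent adds)) ∷ unique
        ; rest = rest
        ; rest⊆A = λ x → remove⊆ A e x ∘ rest⊆A x
        ; edges∉rest = λ { (here refl) → ⊆ᵇ-false rest⊆A (Adds.absent adds) ; (there e∈) → edges∉rest e∈ }
        ; rest-balanced = rest-balanced }
        where
        open Peeled (peel fuel (<-≤-trans shrinks (s≤s⁻¹ bounded))
                      (remove-moves-supply adds (subst (λ x → Balanced A (x ∷ σ) _) (sym src≡v) bal)))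

  decompose : ∀ {A j s t} → Balanced A (replicate j s) (replicate j t) → DisjointPaths (λ e → A e ≡ true) s t j
  decompose {j = zero} _ = [] , none , []
  decompose {A} {suc j} {t = t} bal with peel t (suc (count A)) ≤-refl bal
  ... | peeled with decompose (Peeled.rest-balanced peeled)
  ...   | es , ps , unique-es = edges ++ es , more walk (paths-map (rest⊆A _) ps) , ++⁺ unique unique-es disjoint
    where
    open Peeled peeled
    disjoint : Disjoint edges es
    disjoint (e∈ , e∈es) = not-¬ (paths-edge-ok ps e∈es) (edges∉rest e∈)

module FordFulkerson (D : Digraph) (ok : Edge D → Bool) (s t : Vertex D) where

  open Walks D
  open Flows D

  OK : Edge D → Set
  OK e = ok e ≡ true

  -- Residual edges are forward (inj₁) or reversed (inj₂) copies of the edges of D.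
  from to : Edge D ⊎ Edge D → Vertex D
  from = [ src D , tgt D ]′
  to = [ tgt D , src D ]′

  usable : (Edge D → Bool) → Edge D ⊎ Edge D → Bool
  usable A (inj₁ e) = ok e ∧ not (A e)
  usable A (inj₂ e) = A e

  Residual : Digraph
  Residual = record { n = n D ; m = m D + m D ; src = from ∘ splitAt (m D) ; tgt = to ∘ splitAt (m D) }

  private module Res = Walks Residual

  residual : (Edge D → Bool) → Edge Residual → Bool
  residual A r = usable A (splitAt (m D) r)

  base : Edge Residual → Edge D
  base r = reduce (splitAt (m D) r)

  usable-injective : ∀ A {x y} → usable A x ≡ true → usable A y ≡ true → reduce x ≡ reduce y → x ≡ y
  usable-injective A {inj₁ e} {inj₁ _} _ _ refl = refl
  usable-injective A {inj₂ e} {inj₂ _} _ _ refl = refl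
  usable-injective A {inj₁ e} {inj₂ _} forward backward refl =
    ⊥-elim (not-¬ backward (not-injective (proj₂ (∧-split (ok e) forward))))
  usable-injective A {inj₂ e} {inj₁ _} backward forward refl =
    ⊥-elim (not-¬ backward (not-injective (proj₂ (∧-split (ok e) forward))))

  residual-injective : ∀ A {r r′} → residual A r ≡ true → residual A r′ ≡ true → base r ≡ base r′ → r ≡ r′
  residual-injective A {r} {r′} usable-r usable-r′ same = begin
    r                                ≡⟨ Fin.join-splitAt (m D) (m D) r ⟨
    join (m D) (m D) (splitAt (m D) r)  ≡⟨ cong (join (m D) (m D)) (usable-injective A {splitAt (m D) r} {splitAt (m D) r′} usable-r usable-r′ same) ⟩
    join (m D) (m D) (splitAt (m D) r′) ≡⟨ Fin.join-splitAt (m D) (m D) r′ ⟩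
    r′                               ∎
    where open ≡-Reasoning

  closed-usable : ∀ {A P} → Res.Closed (λ r → residual A r ≡ true) P →
    ∀ x → usable A x ≡ true → P (from x) ≡ true → P (to x) ≡ true
  closed-usable {A} {P} closed x =
    subst (λ y → usable A y ≡ true → P (from y) ≡ true → P (to y) ≡ true)
          (Fin.splitAt-join (m D) (m D) x) (closed {join (m D) (m D) x})

  unique-bases : ∀ {A u v rs} → Walk Residual (λ r → residual A r ≡ true) u v rs → Unique rs → Unique (map base rs)
  unique-bases nil [] = []
  unique-bases {A} (cons r usable-r _ w) (r∉ ∷ unique) =
    All.map⁺ (All.tabulate λ r′∈ same → All.lookup r∉ r′∈ (residual-injective A usable-r (Res.walk-edge-ok w r′∈) same))
    ∷ unique-bases w unique

  updateAt-agrees : ∀ {A A₀ : Edge D → Bool} {e xs} b → All (e ≢_) xs → (∀ {x} → x ∈ˡ e ∷ xs → A x ≡ A₀ x) →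
    ∀ {x} → x ∈ˡ xs → updateAt A e (λ _ → b) x ≡ A₀ x
  updateAt-agrees {A} {e = e} b e∉ agrees {x} x∈ =
    trans (updateAt-minimal x e A λ x≡e → All.lookup e∉ x∈ (sym x≡e)) (agrees (there x∈))

  augment : ∀ {A₀ A u v rs σ τ} → Walk Residual (λ r → residual A₀ r ≡ true) u v rs → Unique (map base rs) →
    (∀ {x} → x ∈ˡ map base rs → A x ≡ A₀ x) → A ⊆ᵇ ok → Balanced A σ (u ∷ τ) →
    ∃[ A′ ] (A′ ⊆ᵇ ok × Balanced A′ σ (v ∷ τ))
  augment nil _ _ A⊆ok bal = _ , A⊆ok , bal
  augment {A = A} (cons r usable-r refl w) (e∉ ∷ unique) agrees A⊆ok bal
    with splitAt (m D) r
  ... | inj₁ e = augment w unique (updateAt-agrees true e∉ agrees) A′⊆ok (add-moves-demand (insert-adds Ae) bal)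
    where
    Ae : A e ≡ false
    Ae = trans (agrees (here refl)) (not-injective (proj₂ (∧-split (ok e) usable-r)))
    A′⊆ok : insert A e ⊆ᵇ ok
    A′⊆ok x x∈ with insert⁻ A e x∈
    ... | inj₁ refl = proj₁ (∧-split (ok e) usable-r)
    ... | inj₂ Ax = A⊆ok x Ax
  ... | inj₂ e = augment w unique (updateAt-agrees false e∉ agrees) (λ x → A⊆ok x ∘ remove⊆ A e x)
                   (remove-moves-demand (remove-adds (trans (agrees (here refl)) usable-r)) bal)

  reachable : (A : Edge D → Bool) → Reachability.Closure Residual (residual A) s
  reachable A = Reachability.closure Residual (residual A) s

  module Reached A = Reachability.Closure (reachable A)

  module _ {j A} (bal : Balanced A (replicate j s) (replicate j t)) where

    open Reached A renaming (member to R)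

    reachable-cut≤value : R t ≡ false → count (λ e → ok e ∧ leaves R e) ≤ j
    reachable-cut≤value t∉R = begin
      count (λ e → ok e ∧ leaves R e)   ≤⟨ count-mono saturated ⟩
      outflow A R                       ≡⟨ +-identityʳ _ ⟨
      outflow A R + 0                   ≡⟨ cong (outflow A R +_) (within-replicate-∉ R j t∉R) ⟨
      outflow A R + within R (replicate j t) ≡⟨ conserved bal R ⟩
      inflow A R + within R (replicate j s)  ≡⟨ cong₂ _+_ (count-false no-entry) (within-replicate-∈ R j source) ⟩
      j                                 ∎
      where
      open ≤-Reasoning
      saturated : ∀ e → ok e ∧ leaves R e ≡ true → A e ∧ leaves R e ≡ true
      saturated e exit with A e in Ae | ∧-split (ok e) exit
      ... | true | _ , leaving = leaving
      ... | false | ok-e , leaving =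
        ⊥-elim (not-¬ (closed-usable {P = R} closed (inj₁ e) (cong₂ (λ a b → a ∧ not b) ok-e Ae) Rsrc) Rtgt)
        where
        Rsrc = proj₁ (leaves⁻ R leaving)
        Rtgt = proj₂ (leaves⁻ R leaving)
      no-entry : ∀ e → A e ∧ enters R e ≡ false
      no-entry e = ¬-not λ entry →
        let (Ae , entering) = ∧-split (A e) entry
            (Rtgt , Rsrc) = enters⁻ R entering
        in not-¬ (closed-usable {P = R} closed (inj₂ e) Ae Rtgt) Rsrc

  augmenting : ∀ {j A} → A ⊆ᵇ ok → Balanced A (replicate j s) (replicate j t) →
    Reached.member A t ≡ true →
    ∃[ A′ ] (A′ ⊆ᵇ ok × Balanced A′ (replicate (suc j) s) (replicate (suc j) t))
  augmenting {j} {A} A⊆ok bal t∈R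
    with Res.walk⇒trail (proj₂ (Reached.reachable A t∈R))
  ... | rs , trail , unique = augment trail (unique-bases trail unique) (λ _ → refl) A⊆ok (balanced-cons s bal)

  record MaxFlowMinCut : Set where
    field
      value : ℕ
      paths : DisjointPaths OK s t value
      cut : Vertex D → Bool
      s∈cut : cut s ≡ true
      t∉cut : cut t ≡ false
      cut≤value : count (λ e → ok e ∧ leaves cut e) ≤ value

  -- The fuel bounds the number of augmentations, since no flow exceeds the number of edges.
  ford-fulkerson : s ≢ t → ∀ fuel {j A} → m D < j + fuel → A ⊆ᵇ ok →
    Balanced A (replicate j s) (replicate j t) → MaxFlowMinCut
  ford-fulkerson s≢t fuel {j} {A} room A⊆ok bal with Reached.member A t in reached
  ... | false = record
    { value = j ; paths = disjointPaths-map (A⊆ok _) (decompose bal)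
    ; cut = Reached.member A ; s∈cut = Reached.source A ; t∉cut = reached
    ; cut≤value = reachable-cut≤value bal reached }
  ford-fulkerson s≢t zero {j} room A⊆ok bal | true =
    ⊥-elim (<⇒≱ (subst (m D <_) (+-identityʳ j) room) (value≤edges s≢t bal))
  ford-fulkerson s≢t (suc fuel) {j} room A⊆ok bal | true =
    let (A′ , A′⊆ok , bal′) = augmenting A⊆ok bal reached
    in ford-fulkerson s≢t fuel (subst (m D <_) (+-suc j fuel) room) A′⊆ok bal′

  max-flow-min-cut : s ≢ t → MaxFlowMinCut
  max-flow-min-cut s≢t = ford-fulkerson s≢t (suc (m D)) (n<1+n (m D)) (λ _ ()) no-flow

module Preservation (G : Digraph) (s t : Vertex G) (H : EdgeSet G)
  (into-t : ∀ e → tgt G e ≢ t → e ∈ H) (F : EdgeSet G) where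

  open Walks G

  inH inF survives survivesH : Edge G → Bool
  inH = lookup H
  inF = lookup F
  survives e = not (inF e)
  survivesH e = inH e ∧ not (inF e)

  cutH : (Vertex G → Bool) → ℕ
  cutH P = count (λ e → survivesH e ∧ leaves P e)

  Route : (Vertex G → Bool) → Vertex G → Set
  Route P v = ∃[ es ] Walk G (λ e → inF e ≡ false × Inside P e) s v es

  record Bypass (P : Vertex G → Bool) : Set where
    field
      edge : Edge G
      edge∉H : inH edge ≡ false
      edge∉F : inF edge ≡ false
      edge→t : tgt G edge ≡ t
      edge-leaves : leaves P edge ≡ true
      route : Route P (src G edge)

    t∉P : P t ≡ false
    t∉P = subst (λ v → P v ≡ false) edge→t (proj₂ (leaves⁻ P edge-leaves))

  bypass-mono : ∀ {P P′} → P ⊆ᵇ P′ → P′ t ≡ false → Bypass P → Bypass P′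
  bypass-mono {P} {P′} P⊆P′ t∉P′ bp = record
    { edge = edge ; edge∉H = edge∉H ; edge∉F = edge∉F ; edge→t = edge→t
    ; edge-leaves = leaves⁺ P′ (P⊆P′ _ (proj₁ (leaves⁻ P edge-leaves))) (subst (λ v → P′ v ≡ false) (sym edge→t) t∉P′)
    ; route = proj₁ route , walk-map (λ (e∉F , Psrc , Ptgt) → e∉F , P⊆P′ _ Psrc , P⊆P′ _ Ptgt) (proj₂ route) }
    where open Bypass bp

  blocking : (Vertex G → Bool) → Edge G → Bool
  blocking P e = inF e ∨ (survivesH e ∧ leaves P e)

  -- Deleting F and the edges of H ∖ F leaving P cuts t off from s in H but, through the bypass, not in G.
  ftrs-bound : ∀ {r P} → FTRS G s r H → P s ≡ true → Bypass P → r < ∣ F ∣ + cutH P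
  ftrs-bound {r} {P} ftrs Ps bp with ∣ tabulate (blocking P) ∣ ≤? r
  ... | no too-many = begin-strict
    r                             <⟨ ≰⇒> too-many ⟩
    ∣ tabulate (blocking P) ∣     ≡⟨ ∣tabulate∣ (blocking P) ⟩
    count (blocking P)            ≤⟨ count-∨ inF _ ⟩
    count inF + cutH P            ≡⟨ cong (_+ cutH P) (∣∣≡count F) ⟨
    ∣ F ∣ + cutH P                ∎
    where open ≤-Reasoning
  ... | yes few = ⊥-elim (not-¬ (walk-stays P closed Ps (proj₂ H-route)) (Bypass.t∉P bp))
    where
    open Bypass bp
    Y = tabulate (blocking P)
    unblocked : ∀ {e} → inF e ≡ false × Inside P e → Avail G ⊤ Y e
    unblocked {e} (e∉F , inside) =
      ∈⊤ , ∉-tabulate (trans (cong₂ (λ a b → a ∨ (survivesH e ∧ b)) e∉F (inside⇒¬leaves P inside)) (∧-zeroʳ _))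
    edge-unblocked : Avail G ⊤ Y edge
    edge-unblocked = ∈⊤ , ∉-tabulate (cong₂ (λ a b → a ∨ (b ∧ not a) ∧ leaves P edge) edge∉F edge∉H)
    G-route : Reachable G ⊤ Y s t
    G-route = _ , walk-map unblocked (proj₂ route) ++ʷ cons edge edge-unblocked refl (subst (λ v → Walk G (Avail G ⊤ Y) v t []) (sym edge→t) nil)
    H-route : Reachable G H Y s t
    H-route = proj₂ (ftrs Y few t) G-route
    closed : Closed (Avail G H Y) P
    closed {e} (e∈H , e∉Y) Psrc =
      ¬-not λ Ptgt → e∉Y (∈-tabulate (covers (inF e) ([]=⇒lookup e∈H) (leaves⁺ P Psrc Ptgt)))
      where
      covers : ∀ a {b c} → b ≡ true → c ≡ true → a ∨ ((b ∧ not a) ∧ c) ≡ true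
      covers true _ _ = refl
      covers false refl refl = refl

  record Core (P : Vertex G → Bool) : Set where
    field
      Q : Vertex G → Bool
      s∈Q : Q s ≡ true
      Q⊆P : Q ⊆ᵇ P
      cutH-Q≤ : cutH Q ≤ cutH P
      route : ∀ {v} → Q v ≡ true → Route Q v

  core : ∀ P → P s ≡ true → Core P
  core P Ps = record { Q = Q ; s∈Q = s∈Q ; Q⊆P = Q⊆P ; cutH-Q≤ = count-mono exits-P ; route = route }
    where
    stays : Edge G → Bool
    stays e = survivesH e ∧ not (leaves P e)
    open Reachability.Closure (Reachability.closure G stays s)
      renaming (member to Q; source to s∈Q; closed to Q-closed)
    P-closed : Closed (λ e → stays e ≡ true) P
    P-closed {e} stays-e Psrc =
      ¬-not λ Ptgt → not-¬ (proj₂ (∧-split (survivesH e) stays-e)) (cong not (leaves⁺ P Psrc Ptgt))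
    Q⊆P : Q ⊆ᵇ P
    Q⊆P v Qv = walk-stays P P-closed Ps (proj₂ (reachable Qv))
    exits-P : ∀ e → survivesH e ∧ leaves Q e ≡ true → survivesH e ∧ leaves P e ≡ true
    exits-P e exit with ∧-split (survivesH e) exit | leaves P e in leaves-P
    ... | survivesH-e , _ | true = cong (_∧ true) survivesH-e
    ... | survivesH-e , leaves-Q | false =
      ⊥-elim (not-¬ (Q-closed (cong₂ (λ a b → a ∧ not b) survivesH-e leaves-P) (proj₁ (leaves⁻ Q leaves-Q)))
                    (proj₂ (leaves⁻ Q leaves-Q)))
    route : ∀ {v} → Q v ≡ true → Route Q v
    route Qv = proj₁ (reachable Qv) , walk-map survives-inside (walk-inside Q Q-closed s∈Q (proj₂ (reachable Qv)))
      where
      survives-inside : ∀ {e} → stays e ≡ true × Inside Q e → inF e ≡ false × Inside Q e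
      survives-inside {e} (stays-e , inside) =
        not-injective (proj₂ (∧-split (inH e) (proj₁ (∧-split (survivesH e) stays-e)))) , inside

  outside-H→t : ∀ {e} → inH e ≡ false → tgt G e ≡ t
  outside-H→t {e} e∉H with tgt G e ≟ t
  ... | yes e→t = e→t
  ... | no ¬e→t = ⊥-elim (not-¬ ([]=⇒lookup (into-t e ¬e→t)) e∉H)

  bypass : ∀ {Q t′ j} → Q s ≡ true → Q t′ ≡ false → cutH Q < j → (∀ {v} → Q v ≡ true → Route Q v) →
    DisjointPaths (λ e → survives e ≡ true) s t′ j → Bypass Q
  bypass {Q} s∈Q t′∉Q few route paths with Fin.any? (λ e → (survives e ∧ leaves Q e) ∧ not (inH e) Bool.≟ true)
  ... | no ¬escape = ⊥-elim (<⇒≱ few (≤-trans (paths≤cut survives Q s∈Q t′∉Q paths) (count-mono through-H)))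
    where
    through-H : ∀ e → survives e ∧ leaves Q e ≡ true → survivesH e ∧ leaves Q e ≡ true
    through-H e exit with inH e in e∈H
    ... | true = exit
    ... | false = ⊥-elim (¬escape (e , cong₂ (λ a b → a ∧ not b) exit e∈H))
  ... | yes (e , escape) with ∧-split (survives e ∧ leaves Q e) escape
  ...   | exit , e∉H with ∧-split (survives e) exit
  ...     | survives-e , leaves-e = record
    { edge = e ; edge∉H = not-injective e∉H ; edge∉F = not-injective survives-e
    ; edge→t = outside-H→t (not-injective e∉H) ; edge-leaves = leaves-e ; route = route (proj₁ (leaves⁻ Q leaves-e)) }

  cutH-submodular : ∀ P Q → cutH (λ v → P v ∧ Q v) + cutH (λ v → P v ∨ Q v) ≤ cutH P + cutH Q
  cutH-submodular P Q = count-+-mono λ e →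
    edge-submodular (survivesH e) (P (src G e)) (Q (src G e)) (P (tgt G e)) (Q (tgt G e))
    where
    crossing : ∀ a b c d → ⟦ (a ∧ b) ∧ not (c ∧ d) ⟧ + ⟦ (a ∨ b) ∧ not (c ∨ d) ⟧ ≤ ⟦ a ∧ not c ⟧ + ⟦ b ∧ not d ⟧
    crossing true  true  true  true  = ≤ᵇ⇒≤ _ _ _
    crossing true  true  true  false = ≤ᵇ⇒≤ _ _ _
    crossing true  true  false true  = ≤ᵇ⇒≤ _ _ _
    crossing true  true  false false = ≤ᵇ⇒≤ _ _ _
    crossing true  false true  true  = ≤ᵇ⇒≤ _ _ _
    crossing true  false true  false = ≤ᵇ⇒≤ _ _ _
    crossing true  false false true  = ≤ᵇ⇒≤ _ _ _
    crossing true  false false false = ≤ᵇ⇒≤ _ _ _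
    crossing false true  true  true  = ≤ᵇ⇒≤ _ _ _
    crossing false true  true  false = ≤ᵇ⇒≤ _ _ _
    crossing false true  false true  = ≤ᵇ⇒≤ _ _ _
    crossing false true  false false = ≤ᵇ⇒≤ _ _ _
    crossing false false c     d     = z≤n
    edge-submodular : ∀ o a b c d →
      ⟦ o ∧ ((a ∧ b) ∧ not (c ∧ d)) ⟧ + ⟦ o ∧ ((a ∨ b) ∧ not (c ∨ d)) ⟧ ≤ ⟦ o ∧ (a ∧ not c) ⟧ + ⟦ o ∧ (b ∧ not d) ⟧
    edge-submodular true a b c d = crossing a b c d
    edge-submodular false a b c d = z≤n

  cutH≤cut : ∀ P → cutH P ≤ count (leaves P)
  cutH≤cut P = count-mono λ e → proj₂ ∘ ∧-split (survivesH e)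

  cutH<cut : ∀ P {e} → inH e ≡ false → leaves P e ≡ true → cutH P < count (leaves P)
  cutH<cut P {e} e∉H leaves-e =
    count-< (λ x → proj₂ ∘ ∧-split (survivesH x)) (cong (λ b → (b ∧ not (inF e)) ∧ leaves P e) e∉H) leaves-e

  surviving : ∀ {e} → Avail G ⊤ F e → survives e ≡ true
  surviving (_ , e∉F) = cong not (∉⇒lookup-false e∉F)

  available : ∀ {e} → survivesH e ≡ true → Avail G H F e
  available {e} h with ∧-split (inH e) h
  ... | e∈H , e∉F = lookup⇒[]= e H e∈H , λ e∈F → not-¬ ([]=⇒lookup e∈F) (not-injective e∉F)

  restrict : ∀ {t′ j} → HasPaths G H F s t′ j → HasPaths G ⊤ F s t′ j
  restrict = disjointPaths-map λ (_ , e∉F) → ∈⊤ , e∉F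

  module Transfer (lam k f : ℕ) (k≥1 : 1 ≤ k) (mf : MaxFlow G ⊤ ⊥ s t f)
           (ftrs : FTRS G s (f ⊓ lam + k ∸ 1) H) (F≤k : ∣ F ∣ ≤ k) where

    bypass-bound : ∀ {P} → P s ≡ true → Bypass P → f ⊓ lam ≤ cutH P
    bypass-bound {P} Ps bp = +-cancelʳ-≤ k _ _ (begin
      f ⊓ lam + k           ≡⟨ m+[n∸m]≡n (≤-trans k≥1 (m≤n+m k (f ⊓ lam))) ⟨
      suc (f ⊓ lam + k ∸ 1) ≤⟨ ftrs-bound ftrs Ps bp ⟩
      ∣ F ∣ + cutH P        ≤⟨ +-monoˡ-≤ (cutH P) F≤k ⟩
      k + cutH P            ≡⟨ +-comm k (cutH P) ⟩
      cutH P + k            ∎)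
      where open ≤-Reasoning

    s≢t : s ≢ t
    s≢t refl = proj₂ mf (trivial-paths (suc f))

    open FordFulkerson G (λ _ → true) s t using (MaxFlowMinCut; max-flow-min-cut)
    open MaxFlowMinCut (max-flow-min-cut s≢t)
      renaming (value to flowG; paths to pathsG; cut to D; s∈cut to s∈D; t∉cut to t∉D; cut≤value to D≤flowG)

    cut-D≤f : count (leaves D) ≤ f
    cut-D≤f = ≤-trans D≤flowG (≮⇒≥ λ f<flowG →
      proj₂ mf (paths-≤ f<flowG (disjointPaths-map (λ _ → ∈⊤ , ∉⊥) pathsG)))

    f≤cutH : f ⊓ lam ≡ f → ∀ {P} → P s ≡ true → Bypass P → f ≤ cutH P
    f≤cutH μ≡f Ps bp = subst (_≤ _) μ≡f (bypass-bound Ps bp)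

    module _ {t′ j} (paths : DisjointPaths (λ e → survives e ≡ true) s t′ j) where

      bypassed-core : ∀ {P} → P s ≡ true → P t′ ≡ false → cutH P < j → Σ (Core P) (Bypass ∘ Core.Q)
      bypassed-core {P} Ps Pt′ few =
        c , bypass s∈Q (⊆ᵇ-false Q⊆P Pt′) (≤-<-trans cutH-Q≤ few) route paths
        where
        c = core P Ps
        open Core c

      -- Submodularity keeps Q ∩ D small, because Q ∪ D is bypassed and hence has at least f exits.
      uncrossed-small : f ⊓ lam ≡ f → ∀ {Q} → Q s ≡ true → cutH Q < j → Bypass Q → cutH (λ v → Q v ∧ D v) < j
      uncrossed-small μ≡f {Q} s∈Q few bp = +-cancelʳ-< (cutH U) _ _ (begin-strict
        cutH (λ v → Q v ∧ D v) + cutH U ≤⟨ cutH-submodular Q D ⟩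
        cutH Q + cutH D                 <⟨ +-mono-<-≤ few (≤-trans (cutH≤cut D) cut-D≤f) ⟩
        j + f                           ≤⟨ +-monoʳ-≤ j f≤cutH-U ⟩
        j + cutH U                      ∎)
        where
        open ≤-Reasoning
        U : Vertex G → Bool
        U v = Q v ∨ D v
        f≤cutH-U : f ≤ cutH U
        f≤cutH-U = f≤cutH μ≡f (cong (_∨ D s) s∈Q)
          (bypass-mono (λ v Qv → cong (_∨ D v) Qv) (cong₂ _∨_ (Bypass.t∉P bp) t∉D) bp)

      -- For f ≤ λ the bypass found inside D would be one more edge leaving D than the f allowed.
      no-bypass : j ≤ lam → ∀ {Q} → Q s ≡ true → Q t′ ≡ false → cutH Q < j → ¬ Bypass Q
      no-bypass j≤lam {Q} s∈Q t′∉Q few bp with ⊓-sel f lam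
      ... | inj₂ μ≡lam = <⇒≱ (<-≤-trans few j≤lam) (subst (_≤ cutH Q) μ≡lam (bypass-bound s∈Q bp))
      ... | inj₁ μ≡f with bypassed-core (cong₂ _∧_ s∈Q s∈D) (cong (_∧ D t′) t′∉Q) (uncrossed-small μ≡f s∈Q few bp)
      ...   | c , bp′ = <⇒≱ (<-≤-trans (cutH<cut D edge∉H edge-leaves) cut-D≤f) (f≤cutH μ≡f s∈D bp-D)
        where
        bp-D = bypass-mono (λ v → proj₂ ∘ ∧-split (Q v) ∘ Core.Q⊆P c v) t∉D bp′
        open Bypass bp-D

      no-small-cut : j ≤ lam → ∀ {R} → R s ≡ true → R t′ ≡ false → ¬ cutH R < j
      no-small-cut j≤lam s∈R t′∉R few with bypassed-core s∈R t′∉R few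
      ... | c , bp = no-bypass j≤lam s∈Q (⊆ᵇ-false Q⊆P t′∉R) (≤-<-trans cutH-Q≤ few) bp
        where open Core c

    transfer : ∀ {t′ j} → j ≤ lam → HasPaths G ⊤ F s t′ j → HasPaths G H F s t′ j
    transfer {t′} {j} j≤lam G-paths with s ≟ t′
    ... | yes refl = trivial-paths j
    ... | no s≢t′ = disjointPaths-map available (paths-≤ j≤value paths)
      where
      open FordFulkerson.MaxFlowMinCut (FordFulkerson.max-flow-min-cut G survivesH s t′ s≢t′)
      j≤value : j ≤ value
      j≤value = ≤-trans (≮⇒≥ (no-small-cut (disjointPaths-map surviving G-paths) j≤lam {cut} s∈cut t∉cut)) cut≤value

lemma10 : (G : Digraph) → Simple G → (s : Vertex G) → (lam k : ℕ) → 1 ≤ lam → 1 ≤ k →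
    (t : Vertex G) → (f : ℕ) → 1 ≤ f → MaxFlow G ⊤ ⊥ s t f →
    (H : EdgeSet G) → FTRS G s ((f ⊓ lam) + k ∸ 1) H →
    (∀ (e : Edge G) → tgt G e ≢ t → e ∈ H) →
    FTBFP G s lam k H
lemma10 G _ s lam k _ k≥1 t f _ mf H ftrs into-t F F≤k t′ =
  flows-agree , λ many → transfer ≤-refl (drop-path many)
  where
  open Walks G using (drop-path; paths-≤)
  open Preservation G s t H into-t F using (restrict; module Transfer)
  open Transfer lam k f k≥1 mf ftrs F≤k using (transfer)
  flows-agree : ¬ HasPaths G ⊤ F s t′ (suc lam) → ∀ g →
    (MaxFlow G ⊤ F s t′ g → MaxFlow G H F s t′ g) × (MaxFlow G H F s t′ g → MaxFlow G ⊤ F s t′ g)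
  flows-agree few g =
    (λ (paths , ¬more) → transfer (bounded paths) paths , ¬more ∘ restrict) ,
    (λ (paths , ¬more) → restrict paths , λ more → ¬more (transfer (bounded more) more))
    where
    bounded : ∀ {i} → HasPaths G ⊤ F s t′ i → i ≤ lam
    bounded paths = ≮⇒≥ λ lam<i → few (paths-≤ lam<i paths)
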